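{- Any algorithm that takes as input a set of bids $B$ and a set of asks $A$ (with distinct ids) and computes a matching over $(B,A)$ of maximum volume has a worst-case running time of $\Omega(n\log n)$ in the comparison model and $\Omega(n\sqrt{\log n})$ in the binary query model, where $n=|B|+|A|$.
   Context: An order $w$ (a bid or an ask) has four natural-number attributes: an id, a timestamp $\mathsf{timestamp}(w)$, a limit price $\mathsf{price}(w)$, and a quantity $\mathsf{qty}(w)\ge 1$; input orders have distinct ids and distinct timestamps. A bid $b$ and an ask $a$ are tradable if $\mathsf{price}(b)\ge \mathsf{price}(a)$. A transaction between a bid $b$ and an ask $a$ consists of a transaction price and a positive transaction quantity. For a set of transactions $M$ and an order $w$, $\mathsf{Qty}(w,M)$ is the sum of the transaction quantities of transactions in $M$ involving $w$, and $\mathsf{Vol}(M)$ is the sum of all transaction quantities in $M$ (the volume). A set of transactions $M$ is a matching over $(B,A)$ if (i) every transaction in $M$ is between a bid of $B$ and an ask of $A$, (ii) the bid and ask of every transaction are tradable, and (iii) $\mathsf{Qty}(w,M)\le \mathsf{qty}(w)$ for every $w\in B\cup A$. Comparison model: the prices of the orders are not given explicitly; two prices can be compared (is one $\le$ the other) by an oracle in unit time. Binary query model: the oracle can evaluate an arbitrary function $f:\mathbb N\times\mathbb N\to\{0,1\}$ on two prices in unit time. -}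

module Defs where

open import Data.Nat using (ℕ; zero; suc; _+_; _*_; _≤_; _≥_; _≤ᵇ_)
open import Data.Nat.Logarithm using (⌊log₂_⌋)
open import Data.Bool using (Bool; true; false)
open import Data.Fin using (Fin)
open import Data.Sum using (_⊎_; inj₁; inj₂)
open import Data.Product using (_×_; _,_; Σ; ∃; ∃-syntax)
open import Data.List using (List; []; _∷_)
open import Data.List.Relation.Unary.All using (All)
open import Relation.Binary.PropositionalEquality using (_≡_; _≢_)
open import Relation.Nullary using (does)
open import Data.Fin using (_≟_)

record Order : Set where
  field
    oid       : ℕ
    timestamp : ℕ
    price     : ℕ
    qty       : ℕ
open Order public

-- The non-price attributes of an order (given explicitly to an algorithm).
record Info : Set where
  field
    iid        : ℕ
    itimestamp : ℕ
    iqty       : ℕ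
open Info public

info : Order → Info
info w = record { iid = oid w ; itimestamp = timestamp w ; iqty = qty w }

record Input : Set where
  field
    nb   : ℕ
    na   : ℕ
    bids : Fin nb → Order
    asks : Fin na → Order
open Input public

Idx : Input → Set
Idx I = Fin (nb I) ⊎ Fin (na I)

order : (I : Input) → Idx I → Order
order I (inj₁ b) = bids I b
order I (inj₂ a) = asks I a

size : Input → ℕ
size I = nb I + na I

WellFormed : Input → Set
WellFormed I =
  (∀ (i : Idx I) → 1 ≤ qty (order I i)) ×
  (∀ (i j : Idx I) → i ≢ j → oid (order I i) ≢ oid (order I j)) ×
  (∀ (i j : Idx I) → i ≢ j → timestamp (order I i) ≢ timestamp (order I j))

record Transaction (nb na : ℕ) : Set where
  field
    tbid   : Fin nb
    task   : Fin na
    tprice : ℕ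
    tqty   : ℕ
open Transaction public

Transactions : ℕ → ℕ → Set
Transactions nb na = List (Transaction nb na)

involves : ∀ {nb na} → Transaction nb na → Fin nb ⊎ Fin na → Bool
involves t (inj₁ b) = does (tbid t ≟ b)
involves t (inj₂ a) = does (task t ≟ a)

Qty : ∀ {nb na} → Fin nb ⊎ Fin na → Transactions nb na → ℕ
Qty i [] = 0
Qty i (t ∷ M) with involves t i
... | true  = tqty t + Qty i M
... | false = Qty i M

Vol : ∀ {nb na} → Transactions nb na → ℕ
Vol [] = 0
Vol (t ∷ M) = tqty t + Vol M

Tradable : Order → Order → Set
Tradable b a = price b ≥ price a

-- M is a matching over (B, A): (i) by construction of the index type,
-- (ii) each transaction has positive quantity and a tradable bid/ask pair,
-- (iii) Qty(w,M) ≤ qty(w) for every order w.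
IsMatching : (I : Input) → Transactions (nb I) (na I) → Set
IsMatching I M =
  All (λ t → (1 ≤ tqty t) × Tradable (bids I (tbid t)) (asks I (task t))) M ×
  (∀ (i : Idx I) → Qty i M ≤ qty (order I i))

IsMaxMatching : (I : Input) → Transactions (nb I) (na I) → Set
IsMaxMatching I M =
  IsMatching I M × (∀ M′ → IsMatching I M′ → Vol M′ ≤ Vol M)

-- Algorithms as decision trees over an oracle query type.
-- Non-price data (sizes, ids, timestamps, quantities) is given to the
-- algorithm explicitly; prices are only accessible through queries.

data Tree (Q : Set) (nb na : ℕ) : Set where
  leaf : Transactions nb na → Tree Q nb na
  node : Q → (onFalse onTrue : Tree Q nb na) → Tree Q nb na

record QueryModel : Set₁ where
  field
    Query  : ℕ → ℕ → Set
    answer : ∀ {nb na} → Query nb na → (Fin nb ⊎ Fin na → ℕ) → Bool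
open QueryModel public

comparisonModel : QueryModel
comparisonModel = record
  { Query  = λ nb na → (Fin nb ⊎ Fin na) × (Fin nb ⊎ Fin na)
  ; answer = λ { (i , j) p → p i ≤ᵇ p j } }

binaryQueryModel : QueryModel
binaryQueryModel = record
  { Query  = λ nb na → (ℕ → ℕ → Bool) × (Fin nb ⊎ Fin na) × (Fin nb ⊎ Fin na)
  ; answer = λ { (f , i , j) p → f (p i) (p j) } }

Algorithm : QueryModel → Set
Algorithm 𝑄 = (nb na : ℕ) → (Fin nb → Info) → (Fin na → Info) → Tree (Query 𝑄 nb na) nb na

treeOf : (𝑄 : QueryModel) → Algorithm 𝑄 → (I : Input) → Tree (Query 𝑄 (nb I) (na I)) (nb I) (na I)
treeOf 𝑄 alg I = alg (nb I) (na I) (λ b → info (bids I b)) (λ a → info (asks I a))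

prices : (I : Input) → Idx I → ℕ
prices I i = price (order I i)

runTree : (𝑄 : QueryModel) (I : Input) → Tree (Query 𝑄 (nb I) (na I)) (nb I) (na I) → Transactions (nb I) (na I)
runTree 𝑄 I (leaf M) = M
runTree 𝑄 I (node q f t) with answer 𝑄 q (prices I)
... | true  = runTree 𝑄 I t
... | false = runTree 𝑄 I f

steps : (𝑄 : QueryModel) (I : Input) → Tree (Query 𝑄 (nb I) (na I)) (nb I) (na I) → ℕ
steps 𝑄 I (leaf M) = 0
steps 𝑄 I (node q f t) with answer 𝑄 q (prices I)
... | true  = suc (steps 𝑄 I t)
... | false = suc (steps 𝑄 I f)

ComputesMaxMatching : (𝑄 : QueryModel) → Algorithm 𝑄 → Set
ComputesMaxMatching 𝑄 alg =
  ∀ (I : Input) → WellFormed I → IsMaxMatching I (runTree 𝑄 I (treeOf 𝑄 alg I))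

time : (𝑄 : QueryModel) → Algorithm 𝑄 → Input → ℕ
time 𝑄 alg I = steps 𝑄 I (treeOf 𝑄 alg I)

-- Worst-case running time is Ω(g(n)), with g given through a predicate
-- "t ≥ c·g(n)" parametrised by an integer d ≥ 1 encoding c = 1/d:
-- ∃ d ≥ 1, n₀, ∀ n ≥ n₀, ∀ correct alg, ∃ well-formed input of size n
-- on which alg needs time t with Bound d n t.
WorstCaseLowerBound : (𝑄 : QueryModel) → (ℕ → ℕ → ℕ → Set) → Set
WorstCaseLowerBound 𝑄 Bound =
  ∃[ d ] (1 ≤ d × ∃[ n₀ ] (∀ n → n₀ ≤ n →
    ∀ (alg : Algorithm 𝑄) → ComputesMaxMatching 𝑄 alg →
      ∃[ I ] (WellFormed I × size I ≡ n × Bound d n (time 𝑄 alg I))))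

NLogN : ℕ → ℕ → ℕ → Set
NLogN d n t = n * ⌊log₂ n ⌋ ≤ d * t

-- t ≥ (1/d)·n·√(log n), i.e. n²·log n ≤ (d·t)²
NSqrtLogN : ℕ → ℕ → ℕ → Set
NSqrtLogN d n t = n * n * ⌊log₂ n ⌋ ≤ (d * t) * (d * t)

-- For a permutation f of Fin m, take m bids with prices f 0, …, f (m - 1) and asks with prices
-- 0, 1, 2, …, all of quantity 1.  Matching bid b with the ask of price f b is a perfect matching
-- in which every trade is at equal prices.  In a maximum matching every order trades exactly as
-- much as in this one, so its total quantity-weighted bid price and ask price are the same as
-- there, hence equal; as each trade has bid price ≥ ask price, every trade is at equal prices,
-- and the output determines f.  The algorithm never sees the prices, so it runs a single binary
-- decision tree on all m! inputs, and no leaf is a correct output for two of them: some input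
-- needs at least log₂ (m!) = Ω(n log n) queries.  This holds for every binary oracle, in
-- particular in both query models, and n log n dominates n √(log n).

module Submission where

open import Defs
open import Data.Bool using (Bool; true; false; if_then_else_)
import Data.Bool.Properties as Bool
open import Data.Empty using (⊥-elim)
open import Data.Fin as Fin using (Fin; zero; suc; toℕ; _↑ˡ_; join; splitAt; punchIn)
open import Data.Fin.Properties
  using (toℕ-injective; toℕ<n; toℕ-↑ˡ; ↑ˡ-injective; splitAt-join; punchIn-injective; punchInᵢ≢i)
  renaming (suc-injective to Fin-suc-injective)
open import Data.List using (List; []; _∷_; length; map; filter; tabulate; allFin; cartesianProduct)
open import Data.List.Properties using (length-++; length-map; length-tabulate)
open import Data.List.Extrema.Nat using (argmax; f[xs]≤f[argmax])
open import Data.List.Relation.Unary.All as All using (All; []; _∷_)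
import Data.List.Relation.Unary.All.Properties as All
open import Data.List.Relation.Unary.Any as Any using (Any; here; there)
open import Data.List.Relation.Unary.Unique.Propositional using (Unique; []; _∷_)
import Data.List.Relation.Unary.Unique.Propositional.Properties as Unique
open import Data.Nat
  using (ℕ; zero; suc; _+_; _*_; _^_; _!; _≤_; _<_; z≤n; s≤s; s≤s⁻¹; _/_; _%_; ⌊_/2⌋; >-nonZero)
open import Data.Nat.Properties
open import Algebra.Properties.Semiring.Sum +-*-semiring
  using (sum-syntax; sum-cong-≗; sum-replicate-zero; ∑-distrib-+) renaming (sum to ∑)
open import Data.Nat.DivMod using (m≡m%n+[m/n]*n; m%n<n; /-monoˡ-≤)
open import Data.Nat.Induction using (<-wellFounded)
open import Data.Nat.ListAction using (sum)
open import Data.Nat.Logarithm using (⌊log₂_⌋; ⌊log₂⌋-mono-≤; ⌊log₂[2*b]⌋≡1+⌊log₂b⌋; ⌊log₂[2^n]⌋≡n)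
open import Data.Nat.Logarithm.Core using (⌊log2⌋)
open import Data.Nat.Tactic.RingSolver using (solve-∀)
open import Data.Product as Product using (_×_; _,_; proj₁; proj₂; ∃-syntax)
open import Data.Sum as Sum using (_⊎_; inj₁; inj₂)
open import Data.Unit using (⊤; tt)
open import Function using (_∘_; Injective)
open import Induction.WellFounded using (Acc; acc)
open import Relation.Binary.PropositionalEquality
open import Relation.Nullary using (¬_; Dec; does; yes; no)

2^⌊log2⌋≤n : ∀ n (rec : Acc _<_ n) → 1 ≤ n → 2 ^ ⌊log2⌋ n rec ≤ n
2^⌊log2⌋≤n 1 _ _ = ≤-refl
2^⌊log2⌋≤n (suc (suc n)) (acc rs) _ = begin
  2 * 2 ^ ⌊log2⌋ (suc h) _ ≤⟨ *-monoʳ-≤ 2 (2^⌊log2⌋≤n (suc h) _ (s≤s z≤n)) ⟩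
  2 * suc h               ≡⟨ double h ⟩
  2 + (h + h)             ≤⟨ +-monoʳ-≤ 2 h+h≤n ⟩
  2 + n                   ∎
  where
  open ≤-Reasoning
  h : ℕ
  h = ⌊ n /2⌋
  double : ∀ h → 2 * suc h ≡ 2 + (h + h)
  double = solve-∀
  h+h≤n : h + h ≤ n
  h+h≤n = ≤-trans (+-monoʳ-≤ h (⌊n/2⌋≤⌈n/2⌉ n)) (≤-reflexive (⌊n/2⌋+⌈n/2⌉≡n n))

2^⌊log₂n⌋≤n : ∀ {n} → 1 ≤ n → 2 ^ ⌊log₂ n ⌋ ≤ n
2^⌊log₂n⌋≤n {n} = 2^⌊log2⌋≤n n (<-wellFounded n)

2^-cancel-≤ : ∀ {a b} → 2 ^ a ≤ 2 ^ b → a ≤ b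
2^-cancel-≤ {a} {b} le = subst₂ _≤_ (⌊log₂[2^n]⌋≡n a) (⌊log₂[2^n]⌋≡n b) (⌊log₂⌋-mono-≤ le)

[1+r]^k≤[k+r]! : ∀ r k → suc r ^ k ≤ (k + r) !
[1+r]^k≤[k+r]! r zero = 1≤n! r
[1+r]^k≤[k+r]! r (suc k) = *-mono-≤ (s≤s (m≤n+m r k)) ([1+r]^k≤[k+r]! r k)

m≤m*m : ∀ m → m ≤ m * m
m≤m*m zero = z≤n
m≤m*m (suc m) = m≤m*n (suc m) (suc m)

+-≤-tight : ∀ {a b c d} → a ≤ c → b ≤ d → c + d ≤ a + b → a ≡ c × d ≤ b
+-≤-tight {a} {b} {c} {d} a≤c b≤d c+d≤a+b =
  a≡c , +-cancelˡ-≤ c d b (subst (λ x → c + d ≤ x + b) a≡c c+d≤a+b)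
  where
  a≡c : a ≡ c
  a≡c = ≤-antisym a≤c (+-cancelʳ-≤ d c a (≤-trans c+d≤a+b (+-monoʳ-≤ a b≤d)))

∑-mono-≤ : ∀ {n} {x y : Fin n → ℕ} → (∀ i → x i ≤ y i) → ∑ x ≤ ∑ y
∑-mono-≤ {zero} _ = z≤n
∑-mono-≤ {suc n} x≤y = +-mono-≤ (x≤y zero) (∑-mono-≤ (x≤y ∘ suc))

∑-tight⇒≡ : ∀ {n} {x y : Fin n → ℕ} → (∀ i → x i ≤ y i) → ∑ y ≤ ∑ x → ∀ i → x i ≡ y i
∑-tight⇒≡ {suc n} x≤y ∑y≤∑x i with +-≤-tight (x≤y zero) (∑-mono-≤ (x≤y ∘ suc)) ∑y≤∑x
∑-tight⇒≡ {suc n} x≤y ∑y≤∑x zero | x₀≡y₀ , _ = x₀≡y₀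
∑-tight⇒≡ {suc n} x≤y ∑y≤∑x (suc i) | _ , rest = ∑-tight⇒≡ (x≤y ∘ suc) rest i

∑-const-1 : ∀ n → ∑[ i < n ] 1 ≡ n
∑-const-1 zero = refl
∑-const-1 (suc n) = cong suc (∑-const-1 n)

∑-*-zero : ∀ n (g : Fin n → ℕ) → ∑[ j < n ] (g j * 0) ≡ 0
∑-*-zero n g = trans (sum-cong-≗ (*-zeroʳ ∘ g)) (sum-replicate-zero n)

∑-select : ∀ {n} (i : Fin n) (g : Fin n → ℕ) q →
           ∑[ j < n ] (g j * (if does (i Fin.≟ j) then q else 0)) ≡ g i * q
∑-select {suc n} zero g q = trans (cong (g zero * q +_) (∑-*-zero n (g ∘ suc))) (+-identityʳ _)
∑-select (suc i) g q = cong₂ _+_ (*-zeroʳ (g zero)) (∑-select i (g ∘ suc) q)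

module _ {A : Set} {f g : A → ℕ} where

  sum-map-mono-≤ : ∀ {xs} → All (λ x → f x ≤ g x) xs → sum (map f xs) ≤ sum (map g xs)
  sum-map-mono-≤ [] = z≤n
  sum-map-mono-≤ (fx≤gx ∷ rest) = +-mono-≤ fx≤gx (sum-map-mono-≤ rest)

  sum-tight⇒≡ : ∀ {xs} → All (λ x → f x ≤ g x) xs → sum (map g xs) ≤ sum (map f xs) →
                All (λ x → f x ≡ g x) xs
  sum-tight⇒≡ [] _ = []
  sum-tight⇒≡ (fx≤gx ∷ rest) le =
    let fx≡gx , le′ = +-≤-tight fx≤gx (sum-map-mono-≤ rest) le in fx≡gx ∷ sum-tight⇒≡ rest le′

module _ {nb na : ℕ} where

  weight : (Transaction nb na → ℕ) → Transactions nb na → ℕ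
  weight p M = sum (map (λ t → tqty t * p t) M)

  weight-cong : ∀ {p p′ : Transaction nb na → ℕ} {M} → All (λ t → p t ≡ p′ t) M →
                weight p M ≡ weight p′ M
  weight-cong [] = refl
  weight-cong {M = t ∷ _} (eq ∷ eqs) = cong₂ _+_ (cong (tqty t *_) eq) (weight-cong eqs)

  Vol≡weight-1 : ∀ (M : Transactions nb na) → Vol M ≡ weight (λ _ → 1) M
  Vol≡weight-1 [] = refl
  Vol≡weight-1 (t ∷ M) = cong₂ _+_ (sym (*-identityʳ (tqty t))) (Vol≡weight-1 M)

  Qty-∷ : ∀ (w : Fin nb ⊎ Fin na) t (M : Transactions nb na) →
          Qty w (t ∷ M) ≡ (if involves t w then tqty t else 0) + Qty w M
  Qty-∷ w t M with involves t w
  ... | true = refl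
  ... | false = refl

  Qty-none : ∀ {w : Fin nb ⊎ Fin na} {M : Transactions nb na} →
             All (λ t → involves t w ≡ false) M → Qty w M ≡ 0
  Qty-none [] = refl
  Qty-none (eq ∷ eqs) rewrite eq = Qty-none eqs

  Qty-pos⇒Any : ∀ {w : Fin nb ⊎ Fin na} (M : Transactions nb na) →
                1 ≤ Qty w M → Any (λ t → involves t w ≡ true) M
  Qty-pos⇒Any {w} (t ∷ M) pos with involves t w in eq
  ... | true = here eq
  ... | false = there (Qty-pos⇒Any M pos)

  involves-bid : ∀ (t : Transaction nb na) {b} → involves t (inj₁ b) ≡ true → tbid t ≡ b
  involves-bid t {b} eq with tbid t Fin.≟ b | eq
  ... | yes tbid≡b | _ = tbid≡b
  ... | no _ | ()

  involves-ask : ∀ (t : Transaction nb na) {a} → involves t (inj₂ a) ≡ true → task t ≡ a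
  involves-ask t {a} eq with task t Fin.≟ a | eq
  ... | yes task≡a | _ = task≡a
  ... | no _ | ()

  -- ι embeds one side of the book into the orders, and π t is the order of that side traded in t.
  weight≡∑*Qty : ∀ {k} (π : Transaction nb na → Fin k) (ι : Fin k → Fin nb ⊎ Fin na) →
                 (∀ t j → involves t (ι j) ≡ does (π t Fin.≟ j)) →
                 ∀ g M → weight (g ∘ π) M ≡ ∑[ j < k ] (g j * Qty (ι j) M)
  weight≡∑*Qty {k} π ι inv g [] = sym (∑-*-zero k g)
  weight≡∑*Qty {k} π ι inv g (t ∷ M) = begin
    tqty t * g (π t) + weight (g ∘ π) M
      ≡⟨ cong₂ _+_ (*-comm (tqty t) (g (π t))) (weight≡∑*Qty π ι inv g M) ⟩
    g (π t) * tqty t + ∑[ j < k ] (g j * Qty (ι j) M)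
      ≡⟨ cong (_+ _) (∑-select (π t) g (tqty t)) ⟨
    ∑[ j < k ] (g j * δ j) + ∑[ j < k ] (g j * Qty (ι j) M)
      ≡⟨ ∑-distrib-+ (λ j → g j * δ j) (λ j → g j * Qty (ι j) M) ⟨
    ∑[ j < k ] (g j * δ j + g j * Qty (ι j) M)
      ≡⟨ sum-cong-≗ (λ j → trans (sym (*-distribˡ-+ (g j) _ _)) (cong (g j *_) (Qty-step j))) ⟩
    ∑[ j < k ] (g j * Qty (ι j) (t ∷ M))
      ∎
    where
    open ≡-Reasoning
    δ : Fin k → ℕ
    δ j = if does (π t Fin.≟ j) then tqty t else 0
    Qty-step : ∀ j → δ j + Qty (ι j) M ≡ Qty (ι j) (t ∷ M)
    Qty-step j = sym (trans (Qty-∷ (ι j) t M)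
                            (cong (λ b → (if b then tqty t else 0) + Qty (ι j) M) (inv t j)))

  weight-by-bids : ∀ g (M : Transactions nb na) →
                   weight (g ∘ tbid) M ≡ ∑[ b < nb ] (g b * Qty (inj₁ b) M)
  weight-by-bids = weight≡∑*Qty tbid inj₁ (λ _ _ → refl)

  weight-by-asks : ∀ g (M : Transactions nb na) →
                   weight (g ∘ task) M ≡ ∑[ a < na ] (g a * Qty (inj₂ a) M)
  weight-by-asks = weight≡∑*Qty task inj₂ (λ _ _ → refl)

  Vol≡∑Qty-bids : ∀ (M : Transactions nb na) → Vol M ≡ ∑[ b < nb ] Qty (inj₁ b) M
  Vol≡∑Qty-bids M =
    trans (Vol≡weight-1 M) (trans (weight-by-bids _ M) (sum-cong-≗ (λ b → *-identityˡ (Qty (inj₁ b) M))))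

  Vol≡∑Qty-asks : ∀ (M : Transactions nb na) → Vol M ≡ ∑[ a < na ] Qty (inj₂ a) M
  Vol≡∑Qty-asks M =
    trans (Vol≡weight-1 M) (trans (weight-by-asks _ M) (sum-cong-≗ (λ a → *-identityˡ (Qty (inj₂ a) M))))

module _ (I : Input) where

  bidPrice askPrice : Transaction (nb I) (na I) → ℕ
  bidPrice t = price (bids I (tbid t))
  askPrice t = price (asks I (task t))

  AtEqualPrice : Transaction (nb I) (na I) → Set
  AtEqualPrice t = bidPrice t ≡ askPrice t

  Valid : Transaction (nb I) (na I) → Set
  Valid t = 1 ≤ tqty t × Tradable (bids I (tbid t)) (asks I (task t))

  untradable⇒Qty≡0 : ∀ {a M} → (∀ b → ¬ Tradable (bids I b) (asks I a)) → IsMatching I M →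
                     Qty (inj₂ a) M ≡ 0
  untradable⇒Qty≡0 {a} {M} untradable (valid , _) = Qty-none uninvolved
    where
    notInvolved : ∀ {t} → Valid t → involves t (inj₂ a) ≡ false
    notInvolved {t} (_ , tradable) with involves t (inj₂ a) in eq
    ... | true = ⊥-elim (untradable (tbid t)
                   (subst (Tradable (bids I (tbid t)) ∘ asks I) (involves-ask t eq) tradable))
    ... | false = refl
    uninvolved : All (λ t → involves t (inj₂ a) ≡ false) M
    uninvolved = All.map (λ {t} → notInvolved {t}) valid

  IsCapacity : (Idx I → ℕ) → Set
  IsCapacity cap = ∀ {M} → IsMatching I M → ∀ w → Qty w M ≤ cap w

  Full : (Idx I → ℕ) → Transactions (nb I) (na I) → Set
  Full cap M = ∑[ b < nb I ] cap (inj₁ b) ≤ Vol M × ∑[ a < na I ] cap (inj₂ a) ≤ Vol M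

  module _ {cap : Idx I → ℕ} (capacity : IsCapacity cap) where

    full⇒Qty≡cap : ∀ {M} → IsMatching I M → Full cap M → ∀ w → Qty w M ≡ cap w
    full⇒Qty≡cap {M} isM (bidsFull , _) (inj₁ b) =
      ∑-tight⇒≡ (capacity isM ∘ inj₁) (≤-trans bidsFull (≤-reflexive (Vol≡∑Qty-bids M))) b
    full⇒Qty≡cap {M} isM (_ , asksFull) (inj₂ a) =
      ∑-tight⇒≡ (capacity isM ∘ inj₂) (≤-trans asksFull (≤-reflexive (Vol≡∑Qty-asks M))) a

    full⇒bidWeight : ∀ {M} → IsMatching I M → Full cap M →
                     weight bidPrice M ≡ ∑[ b < nb I ] (price (bids I b) * cap (inj₁ b))
    full⇒bidWeight {M} isM full = trans (weight-by-bids _ M)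
      (sum-cong-≗ (λ b → cong (price (bids I b) *_) (full⇒Qty≡cap isM full (inj₁ b))))

    full⇒askWeight : ∀ {M} → IsMatching I M → Full cap M →
                     weight askPrice M ≡ ∑[ a < na I ] (price (asks I a) * cap (inj₂ a))
    full⇒askWeight {M} isM full = trans (weight-by-asks _ M)
      (sum-cong-≗ (λ a → cong (price (asks I a) *_) (full⇒Qty≡cap isM full (inj₂ a))))

    -- The two weights of a full matching are fixed by cap, and M* shows that they coincide.
    maxMatching-atEqualPrice : ∀ {M* M} → IsMatching I M* → Full cap M* → All AtEqualPrice M* →
                               IsMaxMatching I M → All AtEqualPrice M × (∀ w → Qty w M ≡ cap w)
    maxMatching-atEqualPrice {M*} {M} isM* full*@(bidsFull* , asksFull*) equal* (isM , maximal) =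
      All.zipWith (λ {t} → cancel {t}) (proj₁ isM , termwise) , full⇒Qty≡cap isM full
      where
      open ≡-Reasoning
      full : Full cap M
      full = ≤-trans bidsFull* (maximal M* isM*) , ≤-trans asksFull* (maximal M* isM*)
      weights-agree : weight bidPrice M ≡ weight askPrice M
      weights-agree = begin
        weight bidPrice M                               ≡⟨ full⇒bidWeight isM full ⟩
        ∑[ b < nb I ] (price (bids I b) * cap (inj₁ b)) ≡⟨ full⇒bidWeight isM* full* ⟨
        weight bidPrice M*                              ≡⟨ weight-cong equal* ⟩
        weight askPrice M*                              ≡⟨ full⇒askWeight isM* full* ⟩
        ∑[ a < na I ] (price (asks I a) * cap (inj₂ a)) ≡⟨ full⇒askWeight isM full ⟨
        weight askPrice M                               ∎
      scale : ∀ {t} → Valid t → tqty t * askPrice t ≤ tqty t * bidPrice t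
      scale {t} (_ , tradable) = *-monoʳ-≤ (tqty t) tradable
      termwise : All (λ t → tqty t * askPrice t ≡ tqty t * bidPrice t) M
      termwise = sum-tight⇒≡ (All.map (λ {t} → scale {t}) (proj₁ isM)) (≤-reflexive weights-agree)
      cancel : ∀ {t} → Valid t × tqty t * askPrice t ≡ tqty t * bidPrice t → AtEqualPrice t
      cancel {t} ((1≤q , _) , eq) = sym (*-cancelˡ-≡ _ _ (tqty t) {{>-nonZero 1≤q}} eq)

unitOrder : ℕ → ℕ → Order
unitOrder key p = record { oid = key ; timestamp = key ; price = p ; qty = 1 }

unitTrade : ∀ {nb na} → Fin nb → Fin na → Transaction nb na
unitTrade b a = record { tbid = b ; task = a ; tprice = 0 ; tqty = 1 }

-- The asks of index ≥ m are tradable with no bid; they only pad the input to the required size.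
hardInput : (m e : ℕ) → (Fin m → Fin m) → Input
hardInput m e f = record
  { nb = m
  ; na = m + e
  ; bids = λ b → unitOrder (toℕ (join m (m + e) (inj₁ b))) (toℕ (f b))
  ; asks = λ a → unitOrder (toℕ (join m (m + e) (inj₂ a))) (toℕ a)
  }

hardInput-wellFormed : ∀ {m e f} → WellFormed (hardInput m e f)
hardInput-wellFormed {m} {e} {f} = unitQty , distinct oid oid≡key , distinct timestamp timestamp≡key
  where
  I : Input
  I = hardInput m e f
  key : Idx I → ℕ
  key w = toℕ (join m (m + e) w)
  key-injective : ∀ {w w′} → key w ≡ key w′ → w ≡ w′
  key-injective {w} {w′} eq = begin
    w                             ≡⟨ splitAt-join m (m + e) w ⟨
    splitAt m (join m (m + e) w)  ≡⟨ cong (splitAt m) (toℕ-injective eq) ⟩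
    splitAt m (join m (m + e) w′) ≡⟨ splitAt-join m (m + e) w′ ⟩
    w′                            ∎
    where open ≡-Reasoning
  unitQty : ∀ w → 1 ≤ qty (order I w)
  unitQty (inj₁ _) = ≤-refl
  unitQty (inj₂ _) = ≤-refl
  oid≡key : ∀ w → oid (order I w) ≡ key w
  oid≡key (inj₁ _) = refl
  oid≡key (inj₂ _) = refl
  timestamp≡key : ∀ w → timestamp (order I w) ≡ key w
  timestamp≡key (inj₁ _) = refl
  timestamp≡key (inj₂ _) = refl
  distinct : ∀ (attr : Order → ℕ) → (∀ w → attr (order I w) ≡ key w) →
             ∀ w w′ → w ≢ w′ → attr (order I w) ≢ attr (order I w′)
  distinct _ attr≡key w w′ w≢w′ eq =
    w≢w′ (key-injective (trans (sym (attr≡key w)) (trans eq (attr≡key w′))))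

below : ∀ m {e} → Fin (m + e) → ℕ
below zero _ = 0
below (suc m) zero = 1
below (suc m) (suc a) = below m a

∑-below : ∀ m {e} → ∑[ a < m + e ] below m a ≡ m
∑-below zero {e} = sum-replicate-zero e
∑-below (suc m) = cong suc (∑-below m)

below-cases : ∀ m {e} (a : Fin (m + e)) → below m a ≡ 1 ⊎ m ≤ toℕ a
below-cases zero _ = inj₂ z≤n
below-cases (suc m) zero = inj₁ refl
below-cases (suc m) (suc a) = Sum.map₂ s≤s (below-cases m a)

hardCap : ∀ m e → Fin m ⊎ Fin (m + e) → ℕ
hardCap m e (inj₁ _) = 1
hardCap m e (inj₂ a) = below m a

hardCap-isCapacity : ∀ {m e f} → IsCapacity (hardInput m e f) (hardCap m e)
hardCap-isCapacity isM (inj₁ b) = proj₂ isM (inj₁ b)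
hardCap-isCapacity {m} {e} {f} {M} isM (inj₂ a) with below-cases m a
... | inj₁ below≡1 rewrite below≡1 = proj₂ isM (inj₂ a)
... | inj₂ m≤a
  rewrite untradable⇒Qty≡0 (hardInput m e f) (λ b → <⇒≱ (<-≤-trans (toℕ<n (f b)) m≤a)) isM = z≤n

perfectTrade : ∀ {m} e → (Fin m → Fin m) → Fin m → Transaction m (m + e)
perfectTrade e f b = unitTrade b (f b ↑ˡ e)

perfectMatching : ∀ m e → (Fin m → Fin m) → Transactions m (m + e)
perfectMatching m e f = tabulate (perfectTrade e f)

module _ {nb na : ℕ} where

  Vol-unitTrades : ∀ {k} (x : Fin k → Fin nb) (y : Fin k → Fin na) →
                   Vol (tabulate (λ i → unitTrade (x i) (y i))) ≡ k
  Vol-unitTrades {zero} x y = refl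
  Vol-unitTrades {suc k} x y = cong suc (Vol-unitTrades (x ∘ suc) (y ∘ suc))

  Qty-tabulate≤1 : ∀ {k} (g : Fin k → Transaction nb na) w → (∀ i → tqty (g i) ≤ 1) →
                   (∀ {i j} → involves (g i) w ≡ true → involves (g j) w ≡ true → i ≡ j) →
                   Qty w (tabulate g) ≤ 1
  Qty-tabulate≤1 {zero} g w q≤1 unique = z≤n
  Qty-tabulate≤1 {suc k} g w q≤1 unique with involves (g zero) w in eq
  ... | true = begin
    tqty (g zero) + Qty w (tabulate (g ∘ suc))
      ≡⟨ cong (tqty (g zero) +_) (Qty-none (All.tabulate⁺ others)) ⟩
    tqty (g zero) + 0
      ≡⟨ +-identityʳ _ ⟩
    tqty (g zero)
      ≤⟨ q≤1 zero ⟩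
    1 ∎
    where
    open ≤-Reasoning
    others : ∀ i → involves (g (suc i)) w ≡ false
    others i with involves (g (suc i)) w in eq′
    ... | true with () ← unique eq eq′
    ... | false = refl
  ... | false = Qty-tabulate≤1 (g ∘ suc) w (q≤1 ∘ suc) (λ p p′ → Fin-suc-injective (unique p p′))

module _ {m e : ℕ} {f : Fin m → Fin m} where

  perfectMatching-atEqualPrice : All (AtEqualPrice (hardInput m e f)) (perfectMatching m e f)
  perfectMatching-atEqualPrice = All.tabulate⁺ (λ b → sym (toℕ-↑ˡ (f b) e))

  perfectMatching-isMatching : Injective _≡_ _≡_ f → IsMatching (hardInput m e f) (perfectMatching m e f)
  perfectMatching-isMatching f-injective =
    All.tabulate⁺ (λ b → ≤-refl , ≤-reflexive (toℕ-↑ˡ (f b) e)) , Qty≤qty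
    where
    Qty≤qty : ∀ w → Qty w (perfectMatching m e f) ≤ qty (order (hardInput m e f) w)
    Qty≤qty (inj₁ b) = Qty-tabulate≤1 (perfectTrade e f) (inj₁ b) (λ _ → ≤-refl) λ {i} {j} p p′ →
      trans (involves-bid (perfectTrade e f i) p) (sym (involves-bid (perfectTrade e f j) p′))
    Qty≤qty (inj₂ a) = Qty-tabulate≤1 (perfectTrade e f) (inj₂ a) (λ _ → ≤-refl) λ {i} {j} p p′ →
      f-injective (↑ˡ-injective e _ _
        (trans (involves-ask (perfectTrade e f i) p) (sym (involves-ask (perfectTrade e f j) p′))))

  perfectMatching-full : Full (hardInput m e f) (hardCap m e) (perfectMatching m e f)
  perfectMatching-full =
    ≤-reflexive (trans (∑-const-1 m) (sym vol)) , ≤-reflexive (trans (∑-below m) (sym vol))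
    where
    vol : Vol (perfectMatching m e f) ≡ m
    vol = Vol-unitTrades (λ b → b) (λ b → f b ↑ˡ e)

  hardInput-maxMatching : Injective _≡_ _≡_ f → ∀ {M} → IsMaxMatching (hardInput m e f) M →
                          All (AtEqualPrice (hardInput m e f)) M × (∀ w → Qty w M ≡ hardCap m e w)
  hardInput-maxMatching f-injective = maxMatching-atEqualPrice (hardInput m e f) hardCap-isCapacity
    (perfectMatching-isMatching f-injective) perfectMatching-full perfectMatching-atEqualPrice

maxMatching-determines : ∀ {m e} {f f′ : Fin m → Fin m} {M} →
                         Injective _≡_ _≡_ f → Injective _≡_ _≡_ f′ →
                         IsMaxMatching (hardInput m e f) M → IsMaxMatching (hardInput m e f′) M →
                         ∀ b → f b ≡ f′ b
maxMatching-determines {f = f} {f′} {M} f-injective f′-injective max max′ b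
  with hardInput-maxMatching f-injective max | hardInput-maxMatching f′-injective max′
... | atEqual , saturated | atEqual′ , _ =
  let (equal , equal′) , tbid≡b = All.lookupAny (All.zip (atEqual , atEqual′)) trades-b
  in subst (λ b → f b ≡ f′ b) tbid≡b (toℕ-injective (trans equal (sym equal′)))
  where
  trades-b : Any (λ t → tbid t ≡ b) M
  trades-b = Any.map (λ {t} → involves-bid t) (Qty-pos⇒Any M (≤-reflexive (sym (saturated (inj₁ b)))))

Code : ℕ → Set
Code zero = ⊤
Code (suc m) = Fin (suc m) × Code m

lehmer : ∀ {m} → Code m → Fin m → Fin m
lehmer {suc m} (c , cs) zero = c
lehmer {suc m} (c , cs) (suc i) = punchIn c (lehmer cs i)

lehmer-injective : ∀ {m} (c : Code m) → Injective _≡_ _≡_ (lehmer c)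
lehmer-injective {suc m} (c , cs) {zero} {zero} _ = refl
lehmer-injective {suc m} (c , cs) {zero} {suc j} eq = ⊥-elim (punchInᵢ≢i c (lehmer cs j) (sym eq))
lehmer-injective {suc m} (c , cs) {suc i} {zero} eq = ⊥-elim (punchInᵢ≢i c (lehmer cs i) eq)
lehmer-injective {suc m} (c , cs) {suc i} {suc j} eq =
  cong suc (lehmer-injective cs (punchIn-injective c (lehmer cs i) (lehmer cs j) eq))

lehmer-cancel : ∀ {m} {c c′ : Code m} → (∀ i → lehmer c i ≡ lehmer c′ i) → c ≡ c′
lehmer-cancel {zero} _ = refl
lehmer-cancel {suc m} {c , cs} {c′ , cs′} same with refl ← same zero =
  cong (c ,_) (lehmer-cancel (λ i → punchIn-injective c (lehmer cs i) (lehmer cs′ i) (same (suc i))))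

codes : ∀ m → List (Code m)
codes zero = tt ∷ []
codes (suc m) = cartesianProduct (allFin (suc m)) (codes m)

code₀ : ∀ m → Code m
code₀ zero = tt
code₀ (suc m) = zero , code₀ m

length-cartesianProduct : ∀ {A B : Set} (xs : List A) (ys : List B) →
                          length (cartesianProduct xs ys) ≡ length xs * length ys
length-cartesianProduct [] ys = refl
length-cartesianProduct (x ∷ xs) ys =
  trans (length-++ (map (x ,_) ys)) (cong₂ _+_ (length-map (x ,_) ys) (length-cartesianProduct xs ys))

length-codes : ∀ m → length (codes m) ≡ m !
length-codes zero = refl
length-codes (suc m) = trans (length-cartesianProduct (allFin (suc m)) (codes m))
                             (cong₂ _*_ (length-tabulate {n = suc m} (λ i → i)) (length-codes m))

codes-unique : ∀ m → Unique (codes m)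
codes-unique zero = [] ∷ []
codes-unique (suc m) = Unique.cartesianProduct⁺ (Unique.allFin⁺ (suc m)) (codes-unique m)

module _ {Q : Set} {nb na : ℕ} where

  run : (Q → Bool) → Tree Q nb na → Transactions nb na
  run oracle (leaf M) = M
  run oracle (node q l r) = if oracle q then run oracle r else run oracle l

  cost : (Q → Bool) → Tree Q nb na → ℕ
  cost oracle (leaf _) = 0
  cost oracle (node q l r) = suc (if oracle q then cost oracle r else cost oracle l)

runTree≡run : ∀ 𝑄 (I : Input) T → runTree 𝑄 I T ≡ run (λ q → answer 𝑄 q (prices I)) T
runTree≡run 𝑄 I (leaf M) = refl
runTree≡run 𝑄 I (node q l r) with answer 𝑄 q (prices I)
... | true = runTree≡run 𝑄 I r
... | false = runTree≡run 𝑄 I l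

steps≡cost : ∀ 𝑄 (I : Input) T → steps 𝑄 I T ≡ cost (λ q → answer 𝑄 q (prices I)) T
steps≡cost 𝑄 I (leaf M) = refl
steps≡cost 𝑄 I (node q l r) with answer 𝑄 q (prices I)
... | true = cong suc (steps≡cost 𝑄 I r)
... | false = cong suc (steps≡cost 𝑄 I l)

length-filter-≟ : ∀ {A : Set} (g : A → Bool) xs →
                  length xs ≡ length (filter (λ x → g x Bool.≟ true) xs)
                            + length (filter (λ x → g x Bool.≟ false) xs)
length-filter-≟ g [] = refl
length-filter-≟ g (x ∷ xs) with g x
... | true = cong suc (length-filter-≟ g xs)
... | false = trans (cong suc (length-filter-≟ g xs)) (sym (+-suc _ _))

module _ {P Q : Set} {nb na : ℕ} (oracle : P → Q → Bool) (Correct : P → Transactions nb na → Set)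
         (separated : ∀ {p p′ M} → Correct p M → Correct p′ M → p ≡ p′) where

  unique-correct⇒length≤1 : ∀ {L M} → Unique L → All (λ p → Correct p M) L → length L ≤ 1
  unique-correct⇒length≤1 [] [] = z≤n
  unique-correct⇒length≤1 (_ ∷ []) (_ ∷ []) = ≤-refl
  unique-correct⇒length≤1 ((p≢p′ ∷ _) ∷ _) (ok ∷ ok′ ∷ _) = ⊥-elim (p≢p′ (separated ok ok′))

  length≤2^cost : ∀ T t {L} → Unique L → All (λ p → Correct p (run (oracle p) T)) L →
                  All (λ p → cost (oracle p) T ≤ t) L → length L ≤ 2 ^ t
  length≤2^cost (leaf M) t unique correct _ = ≤-trans (unique-correct⇒length≤1 unique correct) (m^n>0 2 t)
  length≤2^cost (node q l r) zero {[]} _ _ _ = z≤n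
  length≤2^cost (node q l r) zero {_ ∷ _} _ _ (() ∷ _)
  length≤2^cost (node q l r) (suc t) {L} unique correct fast = begin
    length L                                           ≡⟨ length-filter-≟ (λ p → oracle p q) L ⟩
    length (answering true) + length (answering false) ≤⟨ +-mono-≤ right left ⟩
    2 ^ t + 2 ^ t                                      ≡⟨ cong (2 ^ t +_) (+-identityʳ (2 ^ t)) ⟨
    2 ^ suc t                                          ∎
    where
    open ≤-Reasoning
    answers : ∀ b p → Dec (oracle p q ≡ b)
    answers b p = oracle p q Bool.≟ b
    answering : Bool → List P
    answering b = filter (answers b) L
    along : ∀ b (F : P → Bool → Set) → All (λ p → F p (oracle p q)) L → All (λ p → F p b) (answering b)
    along b F all = All.zipWith (λ {p} (answer≡b , x) → subst (F p) answer≡b x)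
                                (All.all-filter (answers b) L , All.filter⁺ (answers b) all)
    Runs : P → Bool → Set
    Runs p b = Correct p (if b then run (oracle p) r else run (oracle p) l)
    Costs : P → Bool → Set
    Costs p b = (if b then cost (oracle p) r else cost (oracle p) l) ≤ t
    fast′ : All (λ p → Costs p (oracle p q)) L
    fast′ = All.map s≤s⁻¹ fast
    right : length (answering true) ≤ 2 ^ t
    right = length≤2^cost r t (Unique.filter⁺ (answers true) unique)
                          (along true Runs correct) (along true Costs fast′)
    left : length (answering false) ≤ 2 ^ t
    left = length≤2^cost l t (Unique.filter⁺ (answers false) unique)
                         (along false Runs correct) (along false Costs fast′)

hardInput-m!≤2^time : ∀ 𝑄 (alg : Algorithm 𝑄) → ComputesMaxMatching 𝑄 alg → ∀ m e →
                      ∃[ c ] m ! ≤ 2 ^ time 𝑄 alg (hardInput m e (lehmer c))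
hardInput-m!≤2^time 𝑄 alg solves m e = worst , (begin
  m !
    ≡⟨ length-codes m ⟨
  length (codes m)
    ≤⟨ length≤2^cost oracle Correct separated tree (timeOf worst) (codes-unique m) correct fast ⟩
  2 ^ timeOf worst ∎)
  where
  open ≤-Reasoning
  hard : Code m → Input
  hard c = hardInput m e (lehmer c)
  timeOf : Code m → ℕ
  timeOf c = time 𝑄 alg (hard c)
  worst : Code m
  worst = argmax timeOf (code₀ m) (codes m)
  -- The same tree serves every code, since the algorithm is not given the prices.
  tree : Tree (Query 𝑄 m (m + e)) m (m + e)
  tree = treeOf 𝑄 alg (hard worst)
  oracle : Code m → Query 𝑄 m (m + e) → Bool
  oracle c q = answer 𝑄 q (prices (hard c))
  Correct : Code m → Transactions m (m + e) → Set
  Correct c = IsMaxMatching (hard c)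
  separated : ∀ {c c′ M} → Correct c M → Correct c′ M → c ≡ c′
  separated {c} {c′} max max′ =
    lehmer-cancel (maxMatching-determines (lehmer-injective c) (lehmer-injective c′) max max′)
  correct : All (λ c → Correct c (run (oracle c) tree)) (codes m)
  correct = All.tabulate (λ {c} _ →
    subst (Correct c) (runTree≡run 𝑄 (hard c) tree) (solves (hard c) hardInput-wellFormed))
  fast : All (λ c → cost (oracle c) tree ≤ timeOf worst) (codes m)
  fast = All.map (λ {c} → subst (_≤ timeOf worst) (steps≡cost 𝑄 (hard c) tree))
                 (f[xs]≤f[argmax] {f = timeOf} (code₀ m) (codes m))

n⌊log₂n⌋≤21t : ∀ n k t → 1 ≤ k → n < 4 * suc k → (k + k) ! ≤ 2 ^ t → n * ⌊log₂ n ⌋ ≤ 21 * t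
n⌊log₂n⌋≤21t n k t 1≤k n<4[1+k] [2k]!≤2^t = begin
  n * ⌊log₂ n ⌋   ≤⟨ *-mono-≤ n≤7k ⌊log₂n⌋≤3ℓ ⟩
  7 * k * (3 * ℓ) ≡⟨ regroup k ℓ ⟩
  21 * (ℓ * k)    ≤⟨ *-monoʳ-≤ 21 ℓk≤t ⟩
  21 * t          ∎
  where
  open ≤-Reasoning
  ℓ : ℕ
  ℓ = ⌊log₂ suc k ⌋
  regroup : ∀ k ℓ → 7 * k * (3 * ℓ) ≡ 21 * (ℓ * k)
  regroup = solve-∀
  expand : ∀ k → 4 * suc k ≡ suc (3 + 4 * k)
  expand = solve-∀
  ℓk≤t : ℓ * k ≤ t
  ℓk≤t = 2^-cancel-≤ (begin
    2 ^ (ℓ * k) ≡⟨ ^-*-assoc 2 ℓ k ⟨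
    (2 ^ ℓ) ^ k ≤⟨ ^-monoˡ-≤ k (2^⌊log₂n⌋≤n (s≤s z≤n)) ⟩
    suc k ^ k   ≤⟨ [1+r]^k≤[k+r]! k k ⟩
    (k + k) !   ≤⟨ [2k]!≤2^t ⟩
    2 ^ t       ∎)
  1≤ℓ : 1 ≤ ℓ
  1≤ℓ = ⌊log₂⌋-mono-≤ {2} (s≤s 1≤k)
  ⌊log₂n⌋≤3ℓ : ⌊log₂ n ⌋ ≤ 3 * ℓ
  ⌊log₂n⌋≤3ℓ = begin
    ⌊log₂ n ⌋               ≤⟨ ⌊log₂⌋-mono-≤ (<⇒≤ n<4[1+k]) ⟩
    ⌊log₂ 4 * suc k ⌋       ≡⟨ cong ⌊log₂_⌋ (*-assoc 2 2 (suc k)) ⟩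
    ⌊log₂ 2 * (2 * suc k) ⌋ ≡⟨ ⌊log₂[2*b]⌋≡1+⌊log₂b⌋ (2 * suc k) ⟩
    1 + ⌊log₂ 2 * suc k ⌋   ≡⟨ cong suc (⌊log₂[2*b]⌋≡1+⌊log₂b⌋ (suc k)) ⟩
    2 + ℓ                   ≤⟨ +-monoˡ-≤ ℓ (*-monoʳ-≤ 2 1≤ℓ) ⟩
    2 * ℓ + ℓ               ≡⟨ +-comm (2 * ℓ) ℓ ⟩
    3 * ℓ                   ∎
  n≤7k : n ≤ 7 * k
  n≤7k = begin
    n             ≤⟨ s≤s⁻¹ (≤-trans n<4[1+k] (≤-reflexive (expand k))) ⟩
    3 + 4 * k     ≤⟨ +-monoˡ-≤ (4 * k) (*-monoʳ-≤ 3 1≤k) ⟩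
    3 * k + 4 * k ≡⟨ *-distribʳ-+ k 3 4 ⟨
    7 * k         ∎

worstInput-NLogN : ∀ 𝑄 n → 4 ≤ n → (alg : Algorithm 𝑄) → ComputesMaxMatching 𝑄 alg →
                   ∃[ I ] (WellFormed I × size I ≡ n × NLogN 21 n (time 𝑄 alg I))
worstInput-NLogN 𝑄 n 4≤n alg solves =
  let c , [2k]!≤2^t = hardInput-m!≤2^time 𝑄 alg solves (k + k) (n % 4)
      I = hardInput (k + k) (n % 4) (lehmer c)
  in I , hardInput-wellFormed , size≡n , n⌊log₂n⌋≤21t n k (time 𝑄 alg I) 1≤k n<4[1+k] [2k]!≤2^t
  where
  k : ℕ
  k = n / 4
  division : n ≡ n % 4 + k * 4
  division = m≡m%n+[m/n]*n n 4
  regroup : ∀ k r → (k + k) + ((k + k) + r) ≡ r + k * 4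
  regroup = solve-∀
  size≡n : (k + k) + ((k + k) + n % 4) ≡ n
  size≡n = trans (regroup k (n % 4)) (sym division)
  1≤k : 1 ≤ k
  1≤k = /-monoˡ-≤ 4 4≤n
  expand : ∀ k → 4 + k * 4 ≡ 4 * suc k
  expand = solve-∀
  n<4[1+k] : n < 4 * suc k
  n<4[1+k] = subst₂ _<_ (sym division) (expand k) (+-monoˡ-< (k * 4) (m%n<n n 4))

NLogN⇒NSqrtLogN : ∀ d n t → NLogN d n t → NSqrtLogN d n t
NLogN⇒NSqrtLogN d n t n⌊log₂n⌋≤dt = begin
  n * n * ℓ         ≤⟨ *-monoʳ-≤ (n * n) (m≤m*m ℓ) ⟩
  n * n * (ℓ * ℓ)   ≡⟨ regroup n ℓ ⟩
  (n * ℓ) * (n * ℓ) ≤⟨ *-mono-≤ n⌊log₂n⌋≤dt n⌊log₂n⌋≤dt ⟩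
  (d * t) * (d * t) ∎
  where
  open ≤-Reasoning
  ℓ : ℕ
  ℓ = ⌊log₂ n ⌋
  regroup : ∀ n ℓ → n * n * (ℓ * ℓ) ≡ (n * ℓ) * (n * ℓ)
  regroup = solve-∀

WorstCaseLowerBound-mono : ∀ {𝑄 B B′} → (∀ d n t → B d n t → B′ d n t) →
                           WorstCaseLowerBound 𝑄 B → WorstCaseLowerBound 𝑄 B′
WorstCaseLowerBound-mono weaken (d , 1≤d , n₀ , bound) =
  d , 1≤d , n₀ , λ n n₀≤n alg solves →
    Product.map₂ (Product.map₂ (Product.map₂ (weaken d n _))) (bound n n₀≤n alg solves)

mainTheorem1 : WorstCaseLowerBound comparisonModel NLogN × WorstCaseLowerBound binaryQueryModel NSqrtLogN
mainTheorem1 =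
  NLogN-bound comparisonModel , WorstCaseLowerBound-mono NLogN⇒NSqrtLogN (NLogN-bound binaryQueryModel)
  where
  NLogN-bound : ∀ 𝑄 → WorstCaseLowerBound 𝑄 NLogN
  NLogN-bound 𝑄 = 21 , s≤s z≤n , 4 , worstInput-NLogN 𝑄
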